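{- Let $m_{1},m_{2}\in\mathbb{R}^{\mathcal{P}(N)}$ generate distinct extreme rays of the cone of standardized supermodular set functions on $N$. For $i=1,2$, let $o_{i}\in\mathbb{R}^{\Upsilon}$ be given by $o_{i}(a|B)=m_{i}(\{a\}\cup B)-m_{i}(B)$ for $(a|B)\in\Upsilon$, and let $u_{i}$ be the common value of $\langle o_{i},\eta_{H}\rangle$ over all full graphs $H$ over $N$. Then the faces $\{\eta\in P_{\mathrm{FV}}:\ \langle o_{1},\eta\rangle=u_{1}\}$ and $\{\eta\in P_{\mathrm{FV}}:\ \langle o_{2},\eta\rangle=u_{2}\}$ of the family-variable polytope are inclusion-incomparable (neither is contained in the other).
   Context: $N$ is a finite set with $n=|N|\geq 2$; $\mathcal{P}(N)$ is its power set. $\Upsilon=\{(a|B):\ a\in N,\ \emptyset\neq B\subseteq N\setminus\{a\}\}$. For an acyclic directed graph $G$ over $N$, its family-variable vector $\eta_{G}\in\mathbb{R}^{\Upsilon}$ has $\eta_{G}(a|B)=1$ if $B$ is the parent set of $a$ in $G$ and $0$ otherwise. The family-variable polytope $P_{\mathrm{FV}}$ is the convex hull of all $\eta_{G}$, $G$ acyclic directed graph over $N$. A full graph is an acyclic directed graph over $N$ in which every pair of distinct nodes is adjacent. Convention: $o(b|\emptyset)=0$ for all $b\in N$. A set function $m:\mathcal{P}(N)\to\mathbb{R}$ is standardized if $m(S)=0$ whenever $|S|\leq 1$, and supermodular if $m(U)+m(V)\leq m(U\cup V)+m(U\cap V)$ for all $U,V\subseteq N$. The standardized supermodular functions form a pointed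 polyhedral cone; a standardized supermodular function is extreme if it generates an extreme ray of this cone. For a standardized supermodular $m$, the inequality $\langle o,\eta\rangle\leq u$ (with $o$, $u$ defined from $m$ as in the claim) is valid for all $\eta\in P_{\mathrm{FV}}$ and tight at all full graphs; it defines the face $\{\eta\in P_{\mathrm{FV}}:\ \langle o,\eta\rangle=u\}$.
   Formalization: The set functions $m_{1},m_{2}$ and the cone of standardized supermodular set functions are taken over ℚ instead of ℝ, and points of $P_{\mathrm{FV}}$ and its faces are convex combinations with rational coefficients. -}

module Defs where

open import Data.Nat as ℕ using (ℕ; zero; suc)
open import Data.Bool using (Bool; true; false; if_then_else_; _∧_)
open import Data.Fin using (Fin)
open import Data.Fin.Subset using (Subset; _∈_; _∉_; _∪_; _∩_; ⁅_⁆; ∣_∣; Nonempty)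
open import Data.Fin.Subset.Properties using (_∈?_; nonempty?)
open import Data.Vec using (Vec; []; _∷_)
open import Data.Vec.Properties using (≡-dec)
open import Data.List using (List; []; _∷_; [_]; map; concatMap; allFin; foldr)
open import Data.Rational using (ℚ; 0ℚ; 1ℚ; _+_; _*_; _-_; _≤_; _<_)
open import Data.Sum using (_⊎_)
open import Data.List.Relation.Unary.All using (All)
open import Data.Product using (Σ; ∃; _×_; _,_; proj₁; proj₂)
open import Relation.Nullary using (¬_; does)
open import Relation.Nullary.Decidable using (⌊_⌋; ¬?)
open import Relation.Binary.PropositionalEquality using (_≡_)
import Data.Bool as B

allSubsets : ∀ n → List (Subset n)
allSubsets zero = [ [] ]
allSubsets (suc n) = concatMap (λ S → (false ∷ S) ∷ (true ∷ S) ∷ []) (allSubsets n)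

sumℚ : List ℚ → ℚ
sumℚ = foldr _+_ 0ℚ

InΥ : ∀ {n} → Fin n → Subset n → Set
InΥ a B = a ∉ B × Nonempty B

inΥᵇ : ∀ {n} → Fin n → Subset n → Bool
inΥᵇ a B = ⌊ ¬? (a ∈? B) ⌋ ∧ ⌊ nonempty? B ⌋

-- Vectors in ℚ^Υ are represented as functions Fin n → Subset n → ℚ;
-- only the values at (a|B) ∈ Υ are significant.
VecΥ : ℕ → Set
VecΥ n = Fin n → Subset n → ℚ

⟨_,_⟩ : ∀ {n} → VecΥ n → VecΥ n → ℚ
⟨_,_⟩ {n} o η =
  sumℚ (concatMap (λ a → map (λ B → if inΥᵇ a B then o a B * η a B else 0ℚ)
                             (allSubsets n))
                  (allFin n))

_≐_ : ∀ {n} → VecΥ n → VecΥ n → Set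
_≐_ {n} x y = ∀ (a : Fin n) (B : Subset n) → InΥ a B → x a B ≡ y a B

-- Directed graphs over N given by parent sets: b → a is an arrow iff b ∈ pa a.
-- Directed path of length ≥ 1 from b to a.
data Path⁺ {n} (pa : Fin n → Subset n) : Fin n → Fin n → Set where
  edge : ∀ {b a} → b ∈ pa a → Path⁺ pa b a
  step : ∀ {c b a} → Path⁺ pa c b → b ∈ pa a → Path⁺ pa c a

Acyclic : ∀ {n} → (Fin n → Subset n) → Set
Acyclic {n} pa = ∀ (a : Fin n) → ¬ Path⁺ pa a a

record DAG (n : ℕ) : Set where
  field
    pa      : Fin n → Subset n
    acyclic : Acyclic pa
open DAG public

Full : ∀ {n} → DAG n → Set
Full {n} G = ∀ (a b : Fin n) → ¬ a ≡ b → (b ∈ pa G a) ⊎ (a ∈ pa G b)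

ηG : ∀ {n} → DAG n → VecΥ n
ηG G a B = if does (≡-dec B._≟_ B (pa G a)) then 1ℚ else 0ℚ

_∈P-FV : ∀ {n} → VecΥ n → Set
_∈P-FV {n} η =
  Σ (List (ℚ × DAG n)) λ cs →
      All (λ c → 0ℚ ≤ proj₁ c) cs
    × sumℚ (map proj₁ cs) ≡ 1ℚ
    × (η ≐ λ a B → sumℚ (map (λ c → proj₁ c * ηG (proj₂ c) a B) cs))

SetFun : ℕ → Set
SetFun n = Subset n → ℚ

Standardized : ∀ {n} → SetFun n → Set
Standardized {n} m = ∀ (S : Subset n) → ∣ S ∣ ℕ.≤ 1 → m S ≡ 0ℚ

Supermodular : ∀ {n} → SetFun n → Set
Supermodular {n} m = ∀ (U V : Subset n) → m U + m V ≤ m (U ∪ V) + m (U ∩ V)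

InCone : ∀ {n} → SetFun n → Set
InCone m = Standardized m × Supermodular m

Extreme : ∀ {n} → SetFun n → Set
Extreme {n} m =
    InCone m
  × ¬ (∀ (S : Subset n) → m S ≡ 0ℚ)
  × (∀ (m' m'' : SetFun n) → InCone m' → InCone m'' →
       (∀ S → m S ≡ m' S + m'' S) →
       ∃ λ (c : ℚ) → 0ℚ ≤ c × (∀ S → m' S ≡ c * m S))

SameRay : ∀ {n} → SetFun n → SetFun n → Set
SameRay m₁ m₂ = ∃ λ (c : ℚ) → 0ℚ < c × (∀ S → m₂ S ≡ c * m₁ S)

oOf : ∀ {n} → SetFun n → VecΥ n
oOf m a B = m (⁅ a ⁆ ∪ B) - m B

InFace : ∀ {n} → VecΥ n → ℚ → VecΥ n → Set
InFace o u η = η ∈P-FV × ⟨ o , η ⟩ ≡ u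

FaceSubset : ∀ {n} → VecΥ n → ℚ → VecΥ n → ℚ → Set
FaceSubset {n} o₁ u₁ o₂ u₂ = ∀ (η : VecΥ n) → InFace o₁ u₁ η → InFace o₂ u₂ η

-- If the face of m₁ lies inside the face of m₂, every tight supermodular inequality of m₁ is
-- tight for m₂. For a ∉ S ∪ V take a full graph H in which a has parent set S ∪ V, and the
-- graph G obtained by cutting a's parents down to S: then ⟨oᵢ, η_H − η_G⟩ = oᵢ(a|S∪V) − oᵢ(a|S).
-- If this vanishes for m₁, η_G lies on the first face, hence on the second, so it vanishes for m₂.
-- Adding the elements of U ∖ V one at a time writes the gap Δ m (U, V) of the supermodular
-- inequality for (U, V) as a sum of such nonnegative increments, so Δ m₁ (U, V) = 0 forces
-- Δ m₂ (U, V) = 0. By finiteness Δ m₂ ≤ K Δ m₁ for some K > 0, so m₁ − m₂/K is again standardized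
-- and supermodular; extremality of m₁ then makes m₂ a positive multiple of m₁.

module Submission where

open import Defs

open import Data.Bool using (Bool; true; false; if_then_else_; not)
import Data.Bool as Bool
open import Data.Bool.Properties using (not-¬; T-≡)
open import Data.Empty using (⊥-elim)
open import Data.Fin as Fin using (Fin; zero; suc; toℕ; combine)
open import Data.Fin.Patterns using (0F; 1F; 2F)
open import Data.Fin.Properties
  using (_≟_; any?; suc-injective; toℕ-injective; combine-injectiveʳ; combine-monoˡ-<)
open import Data.Fin.Subset using (Subset; _∈_; _∉_; _⊆_; _⊂_; _∪_; _∩_; _─_; ⁅_⁆; ⊥)
open import Data.Fin.Subset.Induction using (⊂-wellFounded; Acc; acc)
open import Data.Fin.Subset.Properties
  using (_∈?_; nonempty?; Empty-unique; ⊆-antisym; ⊥⊆; p⊆p∪q; q⊆p∪q; p∩q⊆p; p─q⊆p;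
         x∈p∪q⁻; x∈p∪q⁺; x∈p∩q⁻; x∈p∩q⁺; x∈⁅x⁆; x∈⁅y⁆⇒x≡y; x∈p∧x≢y⇒x∈p-y; x∈p⇒p-x⊂p;
         ∩-distribʳ-∪; ∪-identityˡ; ∪-identityʳ; ∪-assoc; ∣⁅x⁆∣≡1; ∣⊥∣≡0)
open import Data.List using (List; []; _∷_; map; concatMap; allFin; _++_; cartesianProduct)
open import Data.List.Membership.Propositional using () renaming (_∈_ to _∈ₗ_)
open import Data.List.Membership.Propositional.Properties using (∈-concatMap⁺; ∈-cartesianProduct⁺)
open import Data.List.Properties using (map-cong; map-concatMap; map-tabulate)
open import Data.List.Relation.Unary.All using ([]; _∷_)
open import Data.List.Relation.Unary.Any using (here; there)
import Data.List.Relation.Unary.Any as Any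
open import Data.Nat as ℕ using (ℕ)
import Data.Nat.Properties as ℕ
open import Data.Product using (Σ; _×_; _,_; proj₁; proj₂; uncurry)
open import Data.Rational
  using (ℚ; 0ℚ; 1ℚ; _+_; _*_; _-_; -_; 1/_; _≤_; _<_; NonZero; Positive; ≢-nonZero; nonNegative; positive)
open import Data.Rational.Properties
  using (+-identityˡ; +-identityʳ; +-assoc; +-comm; +-inverseʳ; +-monoˡ-≤; +-monoʳ-≤; +-0-group;
         *-identityˡ; *-identityʳ; *-zeroˡ; *-zeroʳ; *-assoc; *-inverseˡ; *-inverseʳ; *-distribʳ-+;
         *-monoˡ-≤-nonNeg; *-monoʳ-≤-nonNeg; ≤-reflexive; ≤-trans; ≤-antisym; <-≤-trans; <⇒≤;
         positive⁻¹; nonNegative⁻¹; pos⇒nonNeg; pos⇒nonZero; nonNeg∧nonZero⇒pos; 1/pos⇒pos;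
         pos*pos⇒pos; nonNeg*nonNeg⇒nonNeg)
import Data.Rational.Properties as ℚ
open import Data.Rational.Solver using (module +-*-Solver)
open import Data.Sum using (_⊎_; inj₁; inj₂; [_,_]′)
open import Data.Vec using ([]; _∷_; tabulate; here; there)
open import Data.Vec.Functional using (updateAt)
open import Data.Vec.Functional.Properties using (updateAt-updates; updateAt-minimal)
open import Data.Vec.Properties
  using (≡-dec; lookup∘tabulate; []=⇒lookup; lookup⇒[]=; ∷-injectiveˡ; ∷-injectiveʳ)
open import Function using (_∘_; id; const)
open import Function.Bundles using (Equivalence)
open import Relation.Binary using (tri<; tri≈; tri>)
open import Relation.Binary.PropositionalEquality
open import Relation.Nullary using (¬_; yes; no; does)
open import Relation.Nullary.Decidable using (dec-true; dec-false; ¬?; _×-dec_; decidable-stable)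

open import Algebra.Properties.Group +-0-group using (identityʳ-unique)
open +-*-Solver
open ≡-Reasoning

p≤q⇒0≤q-p : ∀ {p q} → p ≤ q → 0ℚ ≤ q - p
p≤q⇒0≤q-p {p} {q} p≤q = subst (_≤ q - p) (+-inverseʳ p) (+-monoˡ-≤ (- p) p≤q)

0≤q-p⇒p≤q : ∀ {p q} → 0ℚ ≤ q - p → p ≤ q
0≤q-p⇒p≤q {p} {q} 0≤q-p =
  subst₂ _≤_ (+-identityˡ p) (solve 2 (λ p q → (q :- p) :+ p := q) refl p q) (+-monoˡ-≤ p 0≤q-p)

+-nonNeg-≡0 : ∀ {p q} → 0ℚ ≤ p → 0ℚ ≤ q → p + q ≡ 0ℚ → p ≡ 0ℚ × q ≡ 0ℚ
+-nonNeg-≡0 {p} {q} 0≤p 0≤q p+q≡0 = below 0≤p 0≤q p+q≡0 , below 0≤q 0≤p (trans (+-comm q p) p+q≡0)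
  where
  below : ∀ {x y} → 0ℚ ≤ x → 0ℚ ≤ y → x + y ≡ 0ℚ → x ≡ 0ℚ
  below {x} {y} 0≤x 0≤y x+y≡0 = ≤-antisym (subst₂ _≤_ (+-identityʳ x) x+y≡0 (+-monoʳ-≤ x 0≤y)) 0≤x

0≤p*q : ∀ {p q} → 0ℚ ≤ p → 0ℚ ≤ q → 0ℚ ≤ p * q
0≤p*q {p} {q} 0≤p 0≤q = nonNegative⁻¹ _ {{nonNeg*nonNeg⇒nonNeg p {{nonNegative 0≤p}} q {{nonNegative 0≤q}}}}

sumℚ-++ : (xs ys : List ℚ) → sumℚ (xs ++ ys) ≡ sumℚ xs + sumℚ ys
sumℚ-++ []       ys = sym (+-identityˡ (sumℚ ys))
sumℚ-++ (x ∷ xs) ys = trans (cong (x +_) (sumℚ-++ xs ys)) (sym (+-assoc x (sumℚ xs) (sumℚ ys)))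

sumℚ-concatMap : ∀ {A : Set} (g : A → List ℚ) (xs : List A) →
                 sumℚ (concatMap g xs) ≡ sumℚ (map (sumℚ ∘ g) xs)
sumℚ-concatMap g []       = refl
sumℚ-concatMap g (x ∷ xs) =
  trans (sumℚ-++ (g x) (concatMap g xs)) (cong (sumℚ (g x) +_) (sumℚ-concatMap g xs))

sumℚ-allSubsets-single : ∀ {n} (f : Subset n → ℚ) (P : Subset n) →
                         (∀ B → B ≢ P → f B ≡ 0ℚ) → sumℚ (map f (allSubsets n)) ≡ f P
sumℚ-allSubsets-single {ℕ.zero} f [] _ = +-identityʳ (f [])
sumℚ-allSubsets-single {ℕ.suc n} f (b ∷ P) vanish = begin
  sumℚ (map f (allSubsets (ℕ.suc n)))
    ≡⟨ cong sumℚ (map-concatMap f _ (allSubsets n)) ⟩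
  sumℚ (concatMap (λ S → f (false ∷ S) ∷ f (true ∷ S) ∷ []) (allSubsets n))
    ≡⟨ sumℚ-concatMap _ (allSubsets n) ⟩
  sumℚ (map (λ S → f (false ∷ S) + (f (true ∷ S) + 0ℚ)) (allSubsets n))
    ≡⟨ cong sumℚ (map-cong (λ S → sum-bit b S (vanish (not b ∷ S) (not-¬ refl ∘ sym ∘ ∷-injectiveˡ)))
                           (allSubsets n)) ⟩
  sumℚ (map (f ∘ (b ∷_)) (allSubsets n))
    ≡⟨ sumℚ-allSubsets-single (f ∘ (b ∷_)) P (λ B B≢P → vanish (b ∷ B) (B≢P ∘ ∷-injectiveʳ)) ⟩
  f (b ∷ P) ∎
  where
  sum-bit : ∀ b S → f (not b ∷ S) ≡ 0ℚ → f (false ∷ S) + (f (true ∷ S) + 0ℚ) ≡ f (b ∷ S)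
  sum-bit false S f₁≡0 = trans (cong (f (false ∷ S) +_) (trans (+-identityʳ _) f₁≡0)) (+-identityʳ _)
  sum-bit true  S f₀≡0 = trans (cong (_+ (f (true ∷ S) + 0ℚ)) f₀≡0) (trans (+-identityˡ _) (+-identityʳ _))

map-allFin-suc : ∀ {n} (f : Fin (ℕ.suc n) → ℚ) →
                 map f (allFin (ℕ.suc n)) ≡ f zero ∷ map (f ∘ suc) (allFin n)
map-allFin-suc f = cong (f zero ∷_) (trans (map-tabulate suc f) (sym (map-tabulate id (f ∘ suc))))

sumℚ-allFin-except : ∀ {n} (f g : Fin n → ℚ) (a : Fin n) → (∀ b → b ≢ a → f b ≡ g b) →
                     sumℚ (map f (allFin n)) ≡ sumℚ (map g (allFin n)) + (f a - g a)
sumℚ-allFin-except {ℕ.suc n} f g zero agree = begin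
  sumℚ (map f (allFin (ℕ.suc n)))
    ≡⟨ cong sumℚ (map-allFin-suc f) ⟩
  f zero + sumℚ (map (f ∘ suc) (allFin n))
    ≡⟨ cong (λ s → f zero + sumℚ s) (map-cong (λ b → agree (suc b) λ ()) (allFin n)) ⟩
  f zero + sumℚ (map (g ∘ suc) (allFin n))
    ≡⟨ solve 3 (λ x y s → x :+ s := (y :+ s) :+ (x :- y)) refl (f zero) (g zero) _ ⟩
  g zero + sumℚ (map (g ∘ suc) (allFin n)) + (f zero - g zero)
    ≡⟨ cong (λ s → sumℚ s + (f zero - g zero)) (map-allFin-suc g) ⟨
  sumℚ (map g (allFin (ℕ.suc n))) + (f zero - g zero) ∎
sumℚ-allFin-except {ℕ.suc n} f g (suc a) agree = begin
  sumℚ (map f (allFin (ℕ.suc n)))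
    ≡⟨ cong sumℚ (map-allFin-suc f) ⟩
  f zero + sumℚ (map (f ∘ suc) (allFin n))
    ≡⟨ cong₂ _+_ (agree zero λ ())
                 (sumℚ-allFin-except (f ∘ suc) (g ∘ suc) a (λ b b≢a → agree (suc b) (b≢a ∘ suc-injective))) ⟩
  g zero + (sumℚ (map (g ∘ suc) (allFin n)) + (f (suc a) - g (suc a)))
    ≡⟨ sym (+-assoc (g zero) _ _) ⟩
  g zero + sumℚ (map (g ∘ suc) (allFin n)) + (f (suc a) - g (suc a))
    ≡⟨ cong (λ s → sumℚ s + (f (suc a) - g (suc a))) (map-allFin-suc g) ⟨
  sumℚ (map g (allFin (ℕ.suc n))) + (f (suc a) - g (suc a)) ∎

∈-allSubsets : ∀ {n} (S : Subset n) → S ∈ₗ allSubsets n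
∈-allSubsets []      = here refl
∈-allSubsets (b ∷ S) =
  ∈-concatMap⁺ (λ S′ → (false ∷ S′) ∷ (true ∷ S′) ∷ []) (Any.map (λ { refl → bit b }) (∈-allSubsets S))
  where
  bit : ∀ b → b ∷ S ∈ₗ (false ∷ S) ∷ (true ∷ S) ∷ []
  bit false = here refl
  bit true  = there (here refl)

-- Inner products with family-variable vectors

localScore : ∀ {n} → VecΥ n → Fin n → Subset n → ℚ
localScore o a B = if inΥᵇ a B then o a B else 0ℚ

ηG-parents : ∀ {n} (G : DAG n) (a : Fin n) → ηG G a (pa G a) ≡ 1ℚ
ηG-parents G a rewrite dec-true (≡-dec Bool._≟_ (pa G a) (pa G a)) refl = refl

ηG-nonparents : ∀ {n} (G : DAG n) (a : Fin n) {B : Subset n} → B ≢ pa G a → ηG G a B ≡ 0ℚ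
ηG-nonparents G a {B} B≢pa rewrite dec-false (≡-dec Bool._≟_ B (pa G a)) B≢pa = refl

inner-ηG : ∀ {n} (o : VecΥ n) (G : DAG n) →
           ⟨ o , ηG G ⟩ ≡ sumℚ (map (λ a → localScore o a (pa G a)) (allFin n))
inner-ηG {n} o G = trans (sumℚ-concatMap _ (allFin n)) (cong sumℚ (map-cong row (allFin n)))
  where
  if-* : ∀ c x y → (if c then x * y else 0ℚ) ≡ (if c then x else 0ℚ) * y
  if-* true  x y = refl
  if-* false x y = sym (*-zeroˡ y)

  vanish : ∀ a B → B ≢ pa G a → localScore o a B * ηG G a B ≡ 0ℚ
  vanish a B B≢pa = trans (cong (localScore o a B *_) (ηG-nonparents G a B≢pa)) (*-zeroʳ (localScore o a B))

  row : ∀ a → sumℚ (map (λ B → if inΥᵇ a B then o a B * ηG G a B else 0ℚ) (allSubsets n))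
              ≡ localScore o a (pa G a)
  row a = begin
    sumℚ (map (λ B → if inΥᵇ a B then o a B * ηG G a B else 0ℚ) (allSubsets n))
      ≡⟨ cong sumℚ (map-cong (λ B → if-* (inΥᵇ a B) (o a B) (ηG G a B)) (allSubsets n)) ⟩
    sumℚ (map (λ B → localScore o a B * ηG G a B) (allSubsets n))
      ≡⟨ sumℚ-allSubsets-single (λ B → localScore o a B * ηG G a B) (pa G a) (vanish a) ⟩
    localScore o a (pa G a) * ηG G a (pa G a)
      ≡⟨ cong (localScore o a (pa G a) *_) (ηG-parents G a) ⟩
    localScore o a (pa G a) * 1ℚ
      ≡⟨ *-identityʳ _ ⟩
    localScore o a (pa G a) ∎

inner-ηG-except : ∀ {n} (o : VecΥ n) (G G′ : DAG n) (a : Fin n) → (∀ b → b ≢ a → pa G b ≡ pa G′ b) →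
                  ⟨ o , ηG G ⟩ ≡ ⟨ o , ηG G′ ⟩ + (localScore o a (pa G a) - localScore o a (pa G′ a))
inner-ηG-except o G G′ a agree = begin
  ⟨ o , ηG G ⟩
    ≡⟨ inner-ηG o G ⟩
  sumℚ (map (λ b → localScore o b (pa G b)) (allFin _))
    ≡⟨ sumℚ-allFin-except _ _ a (λ b b≢a → cong (localScore o b) (agree b b≢a)) ⟩
  sumℚ (map (λ b → localScore o b (pa G′ b)) (allFin _)) + (localScore o a (pa G a) - localScore o a (pa G′ a))
    ≡⟨ cong (_+ (localScore o a (pa G a) - localScore o a (pa G′ a))) (inner-ηG o G′) ⟨
  ⟨ o , ηG G′ ⟩ + (localScore o a (pa G a) - localScore o a (pa G′ a)) ∎

ηG∈P-FV : ∀ {n} (G : DAG n) → ηG G ∈P-FV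
ηG∈P-FV G = (1ℚ , G) ∷ [] , <⇒≤ (positive⁻¹ 1ℚ) ∷ [] , +-identityʳ 1ℚ ,
            λ a B _ → sym (trans (+-identityʳ _) (*-identityˡ _))

-- Acyclic graphs

Path⁺-mono : ∀ {n} {pa pa′ : Fin n → Subset n} → (∀ x → pa′ x ⊆ pa x) →
             ∀ {b a} → Path⁺ pa′ b a → Path⁺ pa b a
Path⁺-mono sub (edge b∈)   = edge (sub _ b∈)
Path⁺-mono sub (step p b∈) = step (Path⁺-mono sub p) (sub _ b∈)

Acyclic-mono : ∀ {n} {pa pa′ : Fin n → Subset n} → (∀ x → pa′ x ⊆ pa x) → Acyclic pa → Acyclic pa′
Acyclic-mono sub acyc a = acyc a ∘ Path⁺-mono sub

restrictParents : ∀ {n} (G : DAG n) (a : Fin n) (S : Subset n) → S ⊆ pa G a → DAG n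
restrictParents G a S S⊆pa = record
  { pa      = updateAt (pa G) a (const S)
  ; acyclic = Acyclic-mono shrinks (acyclic G)
  }
  where
  shrinks : ∀ x → updateAt (pa G) a (const S) x ⊆ pa G x
  shrinks x with x ≟ a
  ... | yes refl rewrite updateAt-updates a {const S} (pa G) = S⊆pa
  ... | no x≢a   rewrite updateAt-minimal x a {const S} (pa G) x≢a = id

acyclic-by-rank : ∀ {n} {pa : Fin n → Subset n} (r : Fin n → ℕ) →
                  (∀ {x y} → y ∈ pa x → r y ℕ.< r x) → Acyclic pa
acyclic-by-rank {pa = pa} r descends a = ℕ.<-irrefl refl ∘ rank-increases
  where
  rank-increases : ∀ {b c} → Path⁺ pa b c → r b ℕ.< r c
  rank-increases (edge b∈)   = descends b∈
  rank-increases (step p b∈) = ℕ.<-trans (rank-increases p) (descends b∈)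

rankParents : ∀ {n} → (Fin n → ℕ) → Fin n → Subset n
rankParents r x = tabulate (λ y → r y ℕ.<ᵇ r x)

∈-rankParents⁻ : ∀ {n} (r : Fin n → ℕ) x {y} → y ∈ rankParents r x → r y ℕ.< r x
∈-rankParents⁻ r x {y} y∈ =
  ℕ.<ᵇ⇒< (r y) (r x) (Equivalence.from T-≡ (trans (sym (lookup∘tabulate _ y)) ([]=⇒lookup y∈)))

∈-rankParents⁺ : ∀ {n} (r : Fin n → ℕ) x {y} → r y ℕ.< r x → y ∈ rankParents r x
∈-rankParents⁺ r x {y} lt = lookup⇒[]= y _ (trans (lookup∘tabulate _ y) (Equivalence.to T-≡ (ℕ.<⇒<ᵇ lt)))

rankDAG : ∀ {n} → (Fin n → ℕ) → DAG n
rankDAG r = record { pa = rankParents r ; acyclic = acyclic-by-rank r (∈-rankParents⁻ r _) }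

rankDAG-full : ∀ {n} (r : Fin n → ℕ) → (∀ {x y} → r x ≡ r y → x ≡ y) → Full (rankDAG r)
rankDAG-full r injective x y x≢y with ℕ.<-cmp (r x) (r y)
... | tri< lt _ _ = inj₂ (∈-rankParents⁺ r y lt)
... | tri≈ _ eq _ = ⊥-elim (x≢y (injective eq))
... | tri> _ _ gt = inj₁ (∈-rankParents⁺ r x gt)

fullDAG-with-parents : ∀ {n} (a : Fin n) (W : Subset n) → a ∉ W →
                       Σ (DAG n) λ H → Full H × pa H a ≡ W
fullDAG-with-parents {n} a W a∉W =
  rankDAG rank , rankDAG-full rank (λ {x} {y} → rank-injective x y) , ⊆-antisym pa⊆W W⊆pa
  where
  -- nodes of W first, then a, then the rest; ties broken by index
  tier : Fin n → Fin 3
  tier y = if does (y ∈? W) then 0F else if does (y ≟ a) then 1F else 2F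

  rank : Fin n → ℕ
  rank y = toℕ (combine (tier y) y)

  rank-injective : ∀ x y → rank x ≡ rank y → x ≡ y
  rank-injective x y eq = combine-injectiveʳ (tier x) x (tier y) y (toℕ-injective eq)

  rank-< : ∀ x y {i j} → tier x ≡ i → tier y ≡ j → i Fin.< j → rank x ℕ.< rank y
  rank-< x y refl refl = combine-monoˡ-< x y

  tier-W : ∀ {y} → y ∈ W → tier y ≡ 0F
  tier-W {y} y∈W rewrite dec-true (y ∈? W) y∈W = refl

  tier-a : tier a ≡ 1F
  tier-a rewrite dec-false (a ∈? W) a∉W | dec-true (a ≟ a) refl = refl

  tier-rest : ∀ {y} → y ∉ W → y ≢ a → tier y ≡ 2F
  tier-rest {y} y∉W y≢a rewrite dec-false (y ∈? W) y∉W | dec-false (y ≟ a) y≢a = refl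

  W⊆pa : W ⊆ rankParents rank a
  W⊆pa {y} y∈W = ∈-rankParents⁺ rank a (rank-< y a (tier-W y∈W) tier-a ℕ.z<s)

  pa⊆W : rankParents rank a ⊆ W
  pa⊆W {y} y∈pa with y ∈? W | y ≟ a
  ... | yes y∈W | _       = y∈W
  ... | no _    | yes refl = ⊥-elim (ℕ.<-irrefl refl (∈-rankParents⁻ rank a y∈pa))
  ... | no y∉W  | no y≢a  =
    ⊥-elim (ℕ.<-asym (∈-rankParents⁻ rank a y∈pa) (rank-< a y tier-a (tier-rest y∉W y≢a) (ℕ.s<s ℕ.z<s)))

⊆⇒∪≡ : ∀ {n} {p q : Subset n} → p ⊆ q → p ∪ q ≡ q
⊆⇒∪≡ {p = p} {q} p⊆q = ⊆-antisym ([ p⊆q , id ]′ ∘ x∈p∪q⁻ p q) (q⊆p∪q p q)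

⊆⇒∩≡ : ∀ {n} {p q : Subset n} → p ⊆ q → p ∩ q ≡ p
⊆⇒∩≡ {p = p} {q} p⊆q = ⊆-antisym (p∩q⊆p p q) (λ x∈p → x∈p∩q⁺ (x∈p , p⊆q x∈p))

x∉p⇒⁅x⁆∩p≡⊥ : ∀ {n} {x : Fin n} {p : Subset n} → x ∉ p → ⁅ x ⁆ ∩ p ≡ ⊥
x∉p⇒⁅x⁆∩p≡⊥ {x = x} {p} x∉p = ⊆-antisym in⊥ ⊥⊆
  where
  in⊥ : ⁅ x ⁆ ∩ p ⊆ ⊥
  in⊥ y∈ with x∈p∩q⁻ ⁅ x ⁆ p y∈
  ... | y∈⁅x⁆ , y∈p = ⊥-elim (x∉p (subst (_∈ p) (x∈⁅y⁆⇒x≡y x y∈⁅x⁆) y∈p))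

x∉q⇒⁅x⁆∪p∩q≡p∩q : ∀ {n} {x : Fin n} (p : Subset n) {q : Subset n} → x ∉ q → (⁅ x ⁆ ∪ p) ∩ q ≡ p ∩ q
x∉q⇒⁅x⁆∪p∩q≡p∩q {x = x} p {q} x∉q = begin
  (⁅ x ⁆ ∪ p) ∩ q          ≡⟨ ∩-distribʳ-∪ q ⁅ x ⁆ p ⟩
  (⁅ x ⁆ ∩ q) ∪ (p ∩ q)    ≡⟨ cong (_∪ (p ∩ q)) (x∉p⇒⁅x⁆∩p≡⊥ x∉q) ⟩
  ⊥ ∪ (p ∩ q)              ≡⟨ ∪-identityˡ (p ∩ q) ⟩
  p ∩ q                    ∎

x∉p─⁅x⁆ : ∀ {n} (x : Fin n) (p : Subset n) → x ∉ p ─ ⁅ x ⁆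
x∉p─⁅x⁆ zero    (_ ∷ p) ()
x∉p─⁅x⁆ (suc x) (_ ∷ p) (there x∈) = x∉p─⁅x⁆ x p x∈

x∈p⇒⁅x⁆∪p─⁅x⁆≡p : ∀ {n} {x : Fin n} {p : Subset n} → x ∈ p → ⁅ x ⁆ ∪ (p ─ ⁅ x ⁆) ≡ p
x∈p⇒⁅x⁆∪p─⁅x⁆≡p {x = x} {p} x∈p = ⊆-antisym (reassemble ∘ x∈p∪q⁻ ⁅ x ⁆ (p ─ ⁅ x ⁆)) split
  where
  reassemble : ∀ {y} → y ∈ ⁅ x ⁆ ⊎ y ∈ p ─ ⁅ x ⁆ → y ∈ p
  reassemble (inj₁ y∈⁅x⁆) = subst (_∈ p) (sym (x∈⁅y⁆⇒x≡y x y∈⁅x⁆)) x∈p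
  reassemble (inj₂ y∈p-x) = p─q⊆p p ⁅ x ⁆ y∈p-x
  split : p ⊆ ⁅ x ⁆ ∪ (p ─ ⁅ x ⁆)
  split {y} y∈p with y ≟ x
  ... | yes refl = x∈p∪q⁺ (inj₁ (x∈⁅x⁆ x))
  ... | no y≢x   = x∈p∪q⁺ (inj₂ (x∈p∧x≢y⇒x∈p-y y∈p y≢x))

Subset-induction-over : ∀ {n} (V : Subset n) (P : Subset n → Set) →
                        (∀ {S} → S ⊆ V → P S) →
                        (∀ {a S} → a ∉ S → a ∉ V → P S → P (⁅ a ⁆ ∪ S)) →
                        ∀ S → P S
Subset-induction-over V P base insert S = go S (⊂-wellFounded S)
  where
  go : ∀ S → Acc _⊂_ S → P S
  go S (acc smaller) with any? (λ x → x ∈? S ×-dec ¬? (x ∈? V))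
  ... | yes (a , a∈S , a∉V) = subst P (x∈p⇒⁅x⁆∪p─⁅x⁆≡p a∈S)
                                (insert (x∉p─⁅x⁆ a S) a∉V (go (S ─ ⁅ a ⁆) (smaller (x∈p⇒p-x⊂p a∈S))))
  ... | no ∄ = base (λ {x} x∈S → decidable-stable (x ∈? V) (λ x∉V → ∄ (x , x∈S , x∉V)))

-- Supermodular gaps

Δ : ∀ {n} → SetFun n → Subset n → Subset n → ℚ
Δ m U V = (m (U ∪ V) + m (U ∩ V)) - (m U + m V)

Supermodular⇒0≤Δ : ∀ {n} (m : SetFun n) → Supermodular m → ∀ U V → 0ℚ ≤ Δ m U V
Supermodular⇒0≤Δ m super U V = p≤q⇒0≤q-p (super U V)

0≤Δ⇒Supermodular : ∀ {n} (m : SetFun n) → (∀ U V → 0ℚ ≤ Δ m U V) → Supermodular m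
0≤Δ⇒Supermodular m 0≤Δ U V = 0≤q-p⇒p≤q (0≤Δ U V)

Δ-⊆ : ∀ {n} (m : SetFun n) {U V : Subset n} → U ⊆ V → Δ m U V ≡ 0ℚ
Δ-⊆ m {U} {V} U⊆V rewrite ⊆⇒∪≡ U⊆V | ⊆⇒∩≡ U⊆V =
  solve 2 (λ u v → (v :+ u) :- (u :+ v) := con 0ℚ) refl (m U) (m V)

oOf-increment≡Δ : ∀ {n} (m : SetFun n) {a : Fin n} {S T : Subset n} → a ∉ T → S ⊆ T →
                  oOf m a T - oOf m a S ≡ Δ m (⁅ a ⁆ ∪ S) T
oOf-increment≡Δ m {a} {S} {T} a∉T S⊆T
  rewrite ∪-assoc ⁅ a ⁆ S T | ⊆⇒∪≡ S⊆T | x∉q⇒⁅x⁆∪p∩q≡p∩q S a∉T | ⊆⇒∩≡ S⊆T =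
  solve 4 (λ aT t aS s → (aT :- t) :- (aS :- s) := (aT :+ s) :- (aS :+ t)) refl
    (m (⁅ a ⁆ ∪ T)) (m T) (m (⁅ a ⁆ ∪ S)) (m S)

Δ-insert : ∀ {n} (m : SetFun n) {a : Fin n} (S : Subset n) {V : Subset n} → a ∉ V →
           Δ m (⁅ a ⁆ ∪ S) V ≡ Δ m S V + (oOf m a (S ∪ V) - oOf m a S)
Δ-insert m {a} S {V} a∉V rewrite ∪-assoc ⁅ a ⁆ S V | x∉q⇒⁅x⁆∪p∩q≡p∩q S a∉V =
  solve 6 (λ aSV SiV aS v SV s →
             (aSV :+ SiV) :- (aS :+ v) := ((SV :+ SiV) :- (s :+ v)) :+ ((aSV :- SV) :- (aS :- s))) refl
    (m (⁅ a ⁆ ∪ (S ∪ V))) (m (S ∩ V)) (m (⁅ a ⁆ ∪ S)) (m V) (m (S ∪ V)) (m S)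

localScore-oOf : ∀ {n} (m : SetFun n) → Standardized m → ∀ {a B} → a ∉ B →
                 localScore (oOf m) a B ≡ oOf m a B
localScore-oOf {n} m standard {a} {B} a∉B with ¬? (a ∈? B) | nonempty? B
... | no a∈B | _        = ⊥-elim (a∈B a∉B)
... | yes _  | yes _    = refl
... | yes _  | no empty rewrite Empty-unique empty | ∪-identityʳ ⁅ a ⁆
                              | standard ⁅ a ⁆ (ℕ.≤-reflexive (∣⁅x⁆∣≡1 a))
                              | standard ⊥ (subst (ℕ._≤ 1) (sym (∣⊥∣≡0 n)) ℕ.z≤n) = refl

0≤oOf-increment : ∀ {n} (m : SetFun n) → Supermodular m → ∀ {a S T} → a ∉ T → S ⊆ T →
                  0ℚ ≤ oOf m a T - oOf m a S
0≤oOf-increment m super a∉T S⊆T =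
  subst (0ℚ ≤_) (sym (oOf-increment≡Δ m a∉T S⊆T)) (Supermodular⇒0≤Δ m super _ _)

Δ-scale : ∀ {n} (c : ℚ) (m : SetFun n) U V → Δ (λ S → c * m S) U V ≡ c * Δ m U V
Δ-scale c m U V =
  solve 5 (λ c a b x y → (c :* a :+ c :* b) :- (c :* x :+ c :* y) := c :* ((a :+ b) :- (x :+ y))) refl
    c (m (U ∪ V)) (m (U ∩ V)) (m U) (m V)

Δ-sub : ∀ {n} (m₁ m₂ : SetFun n) U V → Δ (λ S → m₁ S - m₂ S) U V ≡ Δ m₁ U V - Δ m₂ U V
Δ-sub m₁ m₂ U V =
  solve 8 (λ a b x y a′ b′ x′ y′ → ((a :- a′) :+ (b :- b′)) :- ((x :- x′) :+ (y :- y′))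
                                  := ((a :+ b) :- (x :+ y)) :- ((a′ :+ b′) :- (x′ :+ y′))) refl
    (m₁ (U ∪ V)) (m₁ (U ∩ V)) (m₁ U) (m₁ V) (m₂ (U ∪ V)) (m₂ (U ∩ V)) (m₂ U) (m₂ V)

InCone-scale : ∀ {n} {c : ℚ} (m : SetFun n) → 0ℚ ≤ c → InCone m → InCone (λ S → c * m S)
InCone-scale {c = c} m 0≤c (standard , super) =
  (λ S small → trans (cong (c *_) (standard S small)) (*-zeroʳ c)) ,
  0≤Δ⇒Supermodular (λ S → c * m S)
    (λ U V → subst (0ℚ ≤_) (sym (Δ-scale c m U V)) (0≤p*q 0≤c (Supermodular⇒0≤Δ m super U V)))

InCone-sub : ∀ {n} (m₁ m₂ : SetFun n) → Standardized m₁ → Standardized m₂ →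
             (∀ U V → Δ m₂ U V ≤ Δ m₁ U V) → InCone (λ S → m₁ S - m₂ S)
InCone-sub m₁ m₂ standard₁ standard₂ dom =
  (λ S small → trans (cong₂ _-_ (standard₁ S small) (standard₂ S small)) (+-inverseʳ 0ℚ)) ,
  0≤Δ⇒Supermodular (λ S → m₁ S - m₂ S)
    (λ U V → subst (0ℚ ≤_) (sym (Δ-sub m₁ m₂ U V)) (p≤q⇒0≤q-p (dom U V)))

-- Faces

module _ {n} {m₁ m₂ : SetFun n} {u₁ u₂ : ℚ}
         (standard₁ : Standardized m₁) (standard₂ : Standardized m₂)
         (full₁ : ∀ (H : DAG n) → Full H → ⟨ oOf m₁ , ηG H ⟩ ≡ u₁)
         (full₂ : ∀ (H : DAG n) → Full H → ⟨ oOf m₂ , ηG H ⟩ ≡ u₂)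
         (face₁⊆face₂ : FaceSubset (oOf m₁) u₁ (oOf m₂) u₂) where

  oOf-increment-transfer : ∀ {a S W} → a ∉ W → S ⊆ W →
                           oOf m₁ a W - oOf m₁ a S ≡ 0ℚ → oOf m₂ a W - oOf m₂ a S ≡ 0ℚ
  oOf-increment-transfer {a} {S} {W} a∉W S⊆W zero₁ =
    identityʳ-unique ⟨ oOf m₂ , ηG G ⟩ _ (begin
      ⟨ oOf m₂ , ηG G ⟩ + (oOf m₂ a W - oOf m₂ a S) ≡⟨ score-split m₂ standard₂ ⟨
      ⟨ oOf m₂ , ηG H ⟩                             ≡⟨ full₂ H H-full ⟩
      u₂                                            ≡⟨ proj₂ (face₁⊆face₂ (ηG G) (ηG∈P-FV G , G-on-face₁)) ⟨
      ⟨ oOf m₂ , ηG G ⟩                             ∎)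
    where
    H-data : Σ (DAG n) λ H → Full H × pa H a ≡ W
    H-data = fullDAG-with-parents a W a∉W
    H : DAG n
    H = proj₁ H-data
    H-full : Full H
    H-full = proj₁ (proj₂ H-data)
    paHa≡W : pa H a ≡ W
    paHa≡W = proj₂ (proj₂ H-data)
    G : DAG n
    G = restrictParents H a S (subst (S ⊆_) (sym paHa≡W) S⊆W)

    score-split : ∀ m → Standardized m → ⟨ oOf m , ηG H ⟩ ≡ ⟨ oOf m , ηG G ⟩ + (oOf m a W - oOf m a S)
    score-split m standard = begin
      ⟨ oOf m , ηG H ⟩
        ≡⟨ inner-ηG-except (oOf m) H G a (λ b b≢a → sym (updateAt-minimal b a (pa H) b≢a)) ⟩
      ⟨ oOf m , ηG G ⟩ + (localScore (oOf m) a (pa H a) - localScore (oOf m) a (pa G a))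
        ≡⟨ cong₂ (λ x y → ⟨ oOf m , ηG G ⟩ + (x - y)) at-H at-G ⟩
      ⟨ oOf m , ηG G ⟩ + (oOf m a W - oOf m a S) ∎
      where
      at-H : localScore (oOf m) a (pa H a) ≡ oOf m a W
      at-H = trans (cong (localScore (oOf m) a) paHa≡W) (localScore-oOf m standard a∉W)
      at-G : localScore (oOf m) a (pa G a) ≡ oOf m a S
      at-G = trans (cong (localScore (oOf m) a) (updateAt-updates a (pa H)))
                   (localScore-oOf m standard (a∉W ∘ S⊆W))

    G-on-face₁ : ⟨ oOf m₁ , ηG G ⟩ ≡ u₁
    G-on-face₁ = begin
      ⟨ oOf m₁ , ηG G ⟩                             ≡⟨ +-identityʳ _ ⟨
      ⟨ oOf m₁ , ηG G ⟩ + 0ℚ                        ≡⟨ cong (⟨ oOf m₁ , ηG G ⟩ +_) zero₁ ⟨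
      ⟨ oOf m₁ , ηG G ⟩ + (oOf m₁ a W - oOf m₁ a S) ≡⟨ score-split m₁ standard₁ ⟨
      ⟨ oOf m₁ , ηG H ⟩                             ≡⟨ full₁ H H-full ⟩
      u₁                                            ∎

  Δ-zero-transfer : Supermodular m₁ → ∀ U V → Δ m₁ U V ≡ 0ℚ → Δ m₂ U V ≡ 0ℚ
  Δ-zero-transfer super₁ U V =
    Subset-induction-over V (λ S → Δ m₁ S V ≡ 0ℚ → Δ m₂ S V ≡ 0ℚ) (λ S⊆V _ → Δ-⊆ m₂ S⊆V) insert U
    where
    insert : ∀ {a S} → a ∉ S → a ∉ V → (Δ m₁ S V ≡ 0ℚ → Δ m₂ S V ≡ 0ℚ) →
             Δ m₁ (⁅ a ⁆ ∪ S) V ≡ 0ℚ → Δ m₂ (⁅ a ⁆ ∪ S) V ≡ 0ℚ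
    insert {a} {S} a∉S a∉V ih zero₁ = begin
      Δ m₂ (⁅ a ⁆ ∪ S) V                              ≡⟨ Δ-insert m₂ S a∉V ⟩
      Δ m₂ S V + (oOf m₂ a (S ∪ V) - oOf m₂ a S)
        ≡⟨ cong₂ _+_ (ih (proj₁ zeros₁)) (oOf-increment-transfer a∉S∪V S⊆S∪V (proj₂ zeros₁)) ⟩
      0ℚ + 0ℚ                                         ≡⟨ +-identityʳ 0ℚ ⟩
      0ℚ                                              ∎
      where
      a∉S∪V : a ∉ S ∪ V
      a∉S∪V = [ a∉S , a∉V ]′ ∘ x∈p∪q⁻ S V
      S⊆S∪V : S ⊆ S ∪ V
      S⊆S∪V = p⊆p∪q V
      zeros₁ : Δ m₁ S V ≡ 0ℚ × oOf m₁ a (S ∪ V) - oOf m₁ a S ≡ 0ℚ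
      zeros₁ = +-nonNeg-≡0 (Supermodular⇒0≤Δ m₁ super₁ S V) (0≤oOf-increment m₁ super₁ a∉S∪V S⊆S∪V)
                           (trans (sym (Δ-insert m₁ S a∉V)) zero₁)

-- Extreme rays

dominatingFactor : ∀ {A : Set} (xs : List A) (f g : A → ℚ) →
                   (∀ x → 0ℚ ≤ f x) → (∀ x → 0ℚ ≤ g x) → (∀ x → f x ≡ 0ℚ → g x ≡ 0ℚ) →
                   Σ ℚ λ K → 0ℚ < K × (∀ {x} → x ∈ₗ xs → g x ≤ K * f x)
dominatingFactor []       f g _ _ _ = 1ℚ , positive⁻¹ 1ℚ , λ ()
dominatingFactor (x ∷ xs) f g 0≤f 0≤g vanish with dominatingFactor xs f g 0≤f 0≤g vanish | f x ℚ.≟ 0ℚ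
... | K , 0<K , dom | yes fx≡0 = K , 0<K , λ where
    (here refl) → ≤-reflexive (trans (vanish x fx≡0) (sym (trans (cong (K *_) fx≡0) (*-zeroʳ K))))
    (there y∈)  → dom y∈
... | K , 0<K , dom | no fx≢0 = K + t , <-≤-trans 0<K K≤K+t , λ where
    (here refl) → subst₂ _≤_ (+-identityˡ (g x))
                            (sym (trans (*-distribʳ-+ (f x) K t) (cong (K * f x +_) t*fx≡gx)))
                            (+-monoˡ-≤ (g x) (0≤p*q (<⇒≤ 0<K) (0≤f x)))
    (there y∈)  → ≤-trans (dom y∈) (*-monoʳ-≤-nonNeg (f _) {{nonNegative (0≤f _)}} K≤K+t)
  where
  instance
    0<fx : Positive (f x)
    0<fx = nonNeg∧nonZero⇒pos (f x) {{nonNegative (0≤f x)}} {{≢-nonZero fx≢0}}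
    fx≢0ℚ : NonZero (f x)
    fx≢0ℚ = pos⇒nonZero (f x)
  t : ℚ
  t = g x * 1/ f x
  t*fx≡gx : t * f x ≡ g x
  t*fx≡gx = trans (*-assoc (g x) (1/ f x) (f x)) (trans (cong (g x *_) (*-inverseˡ (f x))) (*-identityʳ (g x)))
  0≤t : 0ℚ ≤ t
  0≤t = 0≤p*q (0≤g x) (nonNegative⁻¹ (1/ f x) {{pos⇒nonNeg (1/ f x) {{1/pos⇒pos (f x)}}}})
  K≤K+t : K ≤ K + t
  K≤K+t = subst (_≤ K + t) (+-identityʳ K) (+-monoʳ-≤ K 0≤t)

Δ-dominated : ∀ {n} (m₁ m₂ : SetFun n) → Supermodular m₁ → Supermodular m₂ →
              (∀ U V → Δ m₁ U V ≡ 0ℚ → Δ m₂ U V ≡ 0ℚ) →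
              Σ ℚ λ K → 0ℚ < K × (∀ U V → Δ m₂ U V ≤ K * Δ m₁ U V)
Δ-dominated {n} m₁ m₂ super₁ super₂ transfer
  with dominatingFactor (cartesianProduct (allSubsets n) (allSubsets n)) (uncurry (Δ m₁)) (uncurry (Δ m₂))
         (uncurry (Supermodular⇒0≤Δ m₁ super₁)) (uncurry (Supermodular⇒0≤Δ m₂ super₂)) (uncurry transfer)
... | K , 0<K , dom = K , 0<K , λ U V → dom (∈-cartesianProduct⁺ (∈-allSubsets U) (∈-allSubsets V))

-- With ε = 1/K, m₁ = ε m₂ + (m₁ - ε m₂) splits m₁ inside the cone.
extreme-dominating⇒SameRay : ∀ {n} {m₁ m₂ : SetFun n} {K : ℚ} → Extreme m₁ → InCone m₂ →
                             ¬ (∀ S → m₂ S ≡ 0ℚ) → 0ℚ < K → (∀ U V → Δ m₂ U V ≤ K * Δ m₁ U V) →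
                             SameRay m₁ m₂
extreme-dominating⇒SameRay {m₁ = m₁} {m₂} {K} ((standard₁ , _) , _ , splits) cone₂ m₂≢0 0<K dom =
  conclude (splits (λ S → ε * m₂ S) (λ S → m₁ S - ε * m₂ S)
                   cone-ε (InCone-sub m₁ (λ S → ε * m₂ S) standard₁ (proj₁ cone-ε) ε-dom)
                   (λ S → solve 3 (λ a b e → a := e :* b :+ (a :- e :* b)) refl (m₁ S) (m₂ S) ε))
  where
  instance
    K-pos : Positive K
    K-pos = positive 0<K
    K-nonZero : NonZero K
    K-nonZero = pos⇒nonZero K
  ε : ℚ
  ε = 1/ K
  0≤ε : 0ℚ ≤ ε
  0≤ε = nonNegative⁻¹ ε {{pos⇒nonNeg ε {{1/pos⇒pos K}}}}
  cancel : ∀ p q → p * q ≡ 1ℚ → ∀ x → p * (q * x) ≡ x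
  cancel p q pq≡1 x = trans (sym (*-assoc p q x)) (trans (cong (_* x) pq≡1) (*-identityˡ x))
  cone-ε : InCone (λ S → ε * m₂ S)
  cone-ε = InCone-scale m₂ 0≤ε cone₂
  ε-dom : ∀ U V → Δ (λ S → ε * m₂ S) U V ≤ Δ m₁ U V
  ε-dom U V = subst₂ _≤_ (sym (Δ-scale ε m₂ U V)) (cancel ε K (*-inverseˡ K) (Δ m₁ U V))
                (*-monoˡ-≤-nonNeg ε {{nonNegative 0≤ε}} (dom U V))
  conclude : (Σ ℚ λ c → 0ℚ ≤ c × (∀ S → ε * m₂ S ≡ c * m₁ S)) → SameRay m₁ m₂
  conclude (c , 0≤c , εm₂≡cm₁) = K * c , positive⁻¹ (K * c) {{pos*pos⇒pos K c}} , m₂≡Kcm₁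
    where
    m₂≡Kcm₁ : ∀ S → m₂ S ≡ K * c * m₁ S
    m₂≡Kcm₁ S = begin
      m₂ S              ≡⟨ cancel K ε (*-inverseʳ K) (m₂ S) ⟨
      K * (ε * m₂ S)    ≡⟨ cong (K *_) (εm₂≡cm₁ S) ⟩
      K * (c * m₁ S)    ≡⟨ *-assoc K c (m₁ S) ⟨
      K * c * m₁ S      ∎
    c≢0 : c ≢ 0ℚ
    c≢0 c≡0 = m₂≢0 λ S → trans (m₂≡Kcm₁ S) (trans (cong (λ x → K * x * m₁ S) c≡0)
                                                   (trans (cong (_* m₁ S) (*-zeroʳ K)) (*-zeroˡ (m₁ S))))
    instance
      c-pos : Positive c
      c-pos = nonNeg∧nonZero⇒pos c {{nonNegative 0≤c}} {{≢-nonZero c≢0}}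

SameRay-sym : ∀ {n} {m₁ m₂ : SetFun n} → SameRay m₁ m₂ → SameRay m₂ m₁
SameRay-sym {m₁ = m₁} {m₂} (c , 0<c , m₂≡cm₁) =
  1/ c , positive⁻¹ (1/ c) {{1/pos⇒pos c}} , λ S → sym (begin
    1/ c * m₂ S         ≡⟨ cong (1/ c *_) (m₂≡cm₁ S) ⟩
    1/ c * (c * m₁ S)   ≡⟨ *-assoc (1/ c) c (m₁ S) ⟨
    1/ c * c * m₁ S     ≡⟨ cong (_* m₁ S) (*-inverseˡ c) ⟩
    1ℚ * m₁ S           ≡⟨ *-identityˡ (m₁ S) ⟩
    m₁ S                ∎)
  where
  instance
    c-pos : Positive c
    c-pos = positive 0<c
    c-nonZero : NonZero c
    c-nonZero = pos⇒nonZero c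

faceSubset⇒SameRay : ∀ {n} {m₁ m₂ : SetFun n} {u₁ u₂ : ℚ} → Extreme m₁ → Extreme m₂ →
                     (∀ (H : DAG n) → Full H → ⟨ oOf m₁ , ηG H ⟩ ≡ u₁) →
                     (∀ (H : DAG n) → Full H → ⟨ oOf m₂ , ηG H ⟩ ≡ u₂) →
                     FaceSubset (oOf m₁) u₁ (oOf m₂) u₂ → SameRay m₁ m₂
faceSubset⇒SameRay {m₁ = m₁} {m₂} extreme₁@((standard₁ , super₁) , _)
                   (cone₂@(standard₂ , super₂) , m₂≢0 , _) full₁ full₂ face₁⊆face₂
  with Δ-dominated m₁ m₂ super₁ super₂ (Δ-zero-transfer standard₁ standard₂ full₁ full₂ face₁⊆face₂ super₁)
... | K , 0<K , dom = extreme-dominating⇒SameRay extreme₁ cone₂ m₂≢0 0<K dom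

lemma8 : (n : ℕ) → 2 ℕ.≤ n → (m₁ m₂ : SetFun n) →
    Extreme m₁ → Extreme m₂ → ¬ SameRay m₁ m₂ →
    (u₁ u₂ : ℚ) →
    (∀ (H : DAG n) → Full H → ⟨ oOf m₁ , ηG H ⟩ ≡ u₁) →
    (∀ (H : DAG n) → Full H → ⟨ oOf m₂ , ηG H ⟩ ≡ u₂) →
    ¬ FaceSubset (oOf m₁) u₁ (oOf m₂) u₂ × ¬ FaceSubset (oOf m₂) u₂ (oOf m₁) u₁
lemma8 n _ m₁ m₂ extreme₁ extreme₂ different u₁ u₂ full₁ full₂ =
  (λ face₁⊆face₂ → different (faceSubset⇒SameRay extreme₁ extreme₂ full₁ full₂ face₁⊆face₂)) ,
  (λ face₂⊆face₁ → different (SameRay-sym (faceSubset⇒SameRay extreme₂ extreme₁ full₂ full₁ face₂⊆face₁)))
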